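{- Let $p$ be a positive integer. A sequence $\alpha:\mathbb N\to\mathbb Z$ is a $p$-prezero stabilizer if and only if it represents an element of the ideal $\mathscr G^{(p)}=p\mathscr P$ of the ring $\mathscr P$ of polyadic numbers.
   Context: $\mathscr A$ denotes the set of all complex-valued periodic functions on $\mathbb Z$. A sequence $\alpha:\mathbb N\to\mathbb Z$ stabilizes $u:\mathbb Z\to\mathbb C$ at the final value $(u\circ\alpha)_\infty=v$ if $u(\alpha_n)=v$ for all but finitely many $n$; $\alpha$ is a stabilizer if it stabilizes every $u\in\mathscr A$; a stabilizer is $p$-prezero if $(u\circ\alpha)_\infty=u(0)$ for every $p$-periodic $u:\mathbb Z\to\mathbb C$. Let $S$ be the shift $(S\alpha)_n=\alpha_{n+1}$ and $\mathscr C_0$ the set of integer sequences $\beta$ such that for every positive integer $n$, $\beta_k\equiv0\pmod n$ for all but finitely many $k$. A polyadic number is a class modulo $\mathscr C_0$ of an integer sequence $\alpha$ with $\alpha-S\alpha\in\mathscr C_0$ (and $\alpha$ represents it); these form a commutative ring $\mathscr P$ under pointwise operations. -}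

module Defs where

open import Data.Nat as ℕ using (ℕ; suc)
open import Data.Integer using (ℤ; +_; _+_; _-_; _*_)
open import Data.Integer.Divisibility using (_∣_)
open import Data.Product using (Σ; ∃; _×_)
open import Relation.Binary.PropositionalEquality using (_≡_)

Seq : Set
Seq = ℕ → ℤ

Periodic : {V : Set} → (ℤ → V) → Set
Periodic u = Σ ℕ λ q → (1 ℕ.≤ q) × (∀ x → u (x + + q) ≡ u x)

PPeriodic : {V : Set} → ℕ → (ℤ → V) → Set
PPeriodic p u = ∀ x → u (x + + p) ≡ u x

Stabilizes : {V : Set} → Seq → (ℤ → V) → V → Set
Stabilizes α u v = Σ ℕ λ N → ∀ n → N ℕ.≤ n → u (α n) ≡ v

-- α is a stabilizer: it stabilizes every periodic function on ℤ.
-- (Values range over an arbitrary type V : Set, in particular ℂ.)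
Stabilizer : Seq → Set₁
Stabilizer α = ∀ (V : Set) (u : ℤ → V) → Periodic u → ∃ λ v → Stabilizes α u v

PrezeroStabilizer : ℕ → Seq → Set₁
PrezeroStabilizer p α =
  Stabilizer α × (∀ (V : Set) (u : ℤ → V) → PPeriodic p u → Stabilizes α u (u (+ 0)))

C₀ : Seq → Set
C₀ β = ∀ (n : ℕ) → 1 ℕ.≤ n → Σ ℕ λ K → ∀ k → K ℕ.≤ k → (+ n) ∣ β k

IsPolyadic : Seq → Set
IsPolyadic α = C₀ (λ n → α n - α (suc n))

-- α represents an element of p𝒫: α is polyadic and its class equals p·[β]
-- for some polyadic β, i.e. α - pβ ∈ 𝒞₀.
RepresentsInPP : ℕ → Seq → Set
RepresentsInPP p α =
  IsPolyadic α × (Σ Seq λ β → IsPolyadic β × C₀ (λ n → α n - (+ p) * β n))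

module Submission where

-- Both directions rest on two facts about periodic functions on ℤ:
--   * a q-periodic function is constant on residue classes modulo q, and
--   * the residue map x ↦ x mod n is n-periodic and separates residue classes.
-- Hence "α stabilizes every periodic function" says exactly that α is eventually
-- constant modulo every n, i.e. that α - Sα ∈ 𝒞₀ (α is polyadic); the forward
-- half uses the residue maps, the backward half telescopes the congruences
-- α k ≡ α (k+1).  Likewise the prezero condition for p says that p ∣ α k
-- eventually.  Given that, β k = ⌊α k / p⌋ is polyadic (cancel p from the
-- congruences of α) and α - pβ is eventually 0; conversely α ≡ pβ modulo p
-- eventually forces p ∣ α k, so every p-periodic u satisfies u (α k) = u 0.
-- The file develops "eventually", periodic functions, residues, the
-- polyadic/stabilizer equivalence and the prezero part, in that order.

open import Defs
open import Data.Nat using (ℕ; _≤_)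
open import Data.Product using (_×_)

open import Data.Nat as ℕ using (suc; _<_; _⊔_; _≤′_; ≤′-refl; ≤′-step; NonZero)
import Data.Nat.Properties as ℕP
import Data.Nat.Divisibility as ℕD
open import Data.Nat.DivMod using (m*n%n≡0)
open import Data.Integer using (ℤ; +_; -[1+_]; _+_; _-_; -_; _*_; ∣_∣; 0ℤ; 1ℤ; _%ℕ_; _/ℕ_)
import Data.Integer.Properties as ℤP
open import Data.Integer.DivMod using (a≡a%ℕn+[a/ℕn]*n; n%ℕd<d)
open import Data.Integer.Divisibility.Signed
  using (_∣_; divides; ∣ᵤ⇒∣; ∣⇒∣ᵤ; ∣m∣n⇒∣m+n; ∣m∣n⇒∣m-n; ∣m+n∣n⇒∣m; *-cancelʳ-∣)
import Data.Integer.Divisibility as Unsigned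
open import Data.Integer.Tactic.RingSolver using (solve-∀)
open import Data.Product using (Σ; _,_)
open import Relation.Binary.PropositionalEquality
  using (_≡_; refl; sym; trans; cong; cong₂; subst; subst₂; module ≡-Reasoning)
open import Relation.Nullary using (contradiction)

Eventually : (ℕ → Set) → Set
Eventually P = Σ ℕ λ K → ∀ k → K ≤ k → P k

eventually-both : ∀ {P Q : ℕ → Set} →
  Eventually P → Eventually Q → Eventually (λ k → P k × Q k)
eventually-both (K , p) (L , q) =
  K ⊔ L , λ k K⊔L≤k → p k (ℕP.m⊔n≤o⇒m≤o K L K⊔L≤k) , q k (ℕP.m⊔n≤o⇒n≤o K L K⊔L≤k)

eventually-next : ∀ {P : ℕ → Set} → Eventually P → Eventually (λ k → P (suc k))
eventually-next (K , p) = K , λ k K≤k → p (suc k) (ℕP.m≤n⇒m≤1+n K≤k)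

eventually-map : ∀ {P Q : ℕ → Set} → (∀ k → P k → Q k) → Eventually P → Eventually Q
eventually-map f (K , p) = K , λ k K≤k → f k (p k K≤k)

periodic-shiftℕ : ∀ {V : Set} {u : ℤ → V} q → PPeriodic q u →
  ∀ x n → u (x + + n * + q) ≡ u x
periodic-shiftℕ {u = u} q per x ℕ.zero = cong u (ℤP.+-identityʳ x)
periodic-shiftℕ {u = u} q per x (suc n) = begin
  u (x + (1ℤ + + n) * + q)    ≡⟨ cong u (regroup x (+ n) (+ q)) ⟩
  u ((x + + n * + q) + + q)   ≡⟨ per (x + + n * + q) ⟩
  u (x + + n * + q)           ≡⟨ periodic-shiftℕ q per x n ⟩
  u x                         ∎
  where
  open ≡-Reasoning
  regroup : ∀ x n q → x + (1ℤ + n) * q ≡ (x + n * q) + q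
  regroup = solve-∀

-- A q-periodic function is invariant under translation by any multiple of q;
-- a negative multiple is undone by the corresponding positive one.
periodic-shift : ∀ {V : Set} {u : ℤ → V} q → PPeriodic q u →
  ∀ x k → u (x + k * + q) ≡ u x
periodic-shift q per x (+ n) = periodic-shiftℕ q per x n
periodic-shift {u = u} q per x k@(-[1+ n ]) = sym (begin
  u x                                     ≡⟨ cong u (undo x (+ suc n) (+ q)) ⟩
  u ((x + k * + q) + + suc n * + q)       ≡⟨ periodic-shiftℕ q per (x + k * + q) (suc n) ⟩
  u (x + k * + q)                         ∎)
  where
  open ≡-Reasoning
  undo : ∀ x m q → x ≡ (x + (- m) * q) + m * q
  undo = solve-∀

periodic-congruent : ∀ {V : Set} {u : ℤ → V} {q} → PPeriodic q u →
  ∀ {x y} → + q ∣ y - x → u y ≡ u x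
periodic-congruent {u = u} {q} per {x} {y} (divides k y-x≡kq) = begin
  u y                ≡⟨ cong u (move-difference x y) ⟩
  u (x + (y - x))    ≡⟨ cong (λ d → u (x + d)) y-x≡kq ⟩
  u (x + k * + q)    ≡⟨ periodic-shift q per x k ⟩
  u x                ∎
  where
  open ≡-Reasoning
  move-difference : ∀ x y → y ≡ x + (y - x)
  move-difference = solve-∀

divisible-below⇒zero : ∀ {n d} → n ℕD.∣ d → d < n → d ≡ 0
divisible-below⇒zero {d = ℕ.zero}  _   _   = refl
divisible-below⇒zero {d = suc _}   n∣d d<n = contradiction n∣d (ℕD.>⇒∤ d<n)

residue-unique : ∀ {n r s} → r < n → s < n → + n ∣ + r - + s → r ≡ s
residue-unique {n} {r} {s} r<n s<n n∣r-s =
  ℤP.+-injective (ℤP.i-j≡0⇒i≡j (+ r) (+ s) (ℤP.∣i∣≡0⇒i≡0 ∣r-s∣≡0))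
  where
  ∣r-s∣<n : ∣ + r - + s ∣ < n
  ∣r-s∣<n = subst (_< n) (cong ∣_∣ (sym (ℤP.m-n≡m⊖n r s)))
                  (ℕP.≤-<-trans (ℤP.∣m⊝n∣≤m⊔n r s) (ℕP.⊔-pres-<m r<n s<n))
  ∣r-s∣≡0 : ∣ + r - + s ∣ ≡ 0
  ∣r-s∣≡0 = divisible-below⇒zero (∣⇒∣ᵤ n∣r-s) ∣r-s∣<n

module _ (n : ℕ) .{{_ : NonZero n}} where

  difference-by-residues : ∀ x y →
    x - y ≡ (+ (x %ℕ n) - + (y %ℕ n)) + (x /ℕ n - y /ℕ n) * + n
  difference-by-residues x y = begin
    x - y
      ≡⟨ cong₂ _-_ (a≡a%ℕn+[a/ℕn]*n x n) (a≡a%ℕn+[a/ℕn]*n y n) ⟩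
    (+ (x %ℕ n) + (x /ℕ n) * + n) - (+ (y %ℕ n) + (y /ℕ n) * + n)
      ≡⟨ regroup (+ (x %ℕ n)) (+ (y %ℕ n)) (x /ℕ n) (y /ℕ n) (+ n) ⟩
    (+ (x %ℕ n) - + (y %ℕ n)) + (x /ℕ n - y /ℕ n) * + n
      ∎
    where
    open ≡-Reasoning
    regroup : ∀ r s a b q → (r + a * q) - (s + b * q) ≡ (r - s) + (a - b) * q
    regroup = solve-∀

  same-residue⇒congruent : ∀ x y → x %ℕ n ≡ y %ℕ n → + n ∣ x - y
  same-residue⇒congruent x y same = divides (x /ℕ n - y /ℕ n) (begin
    x - y                                                ≡⟨ difference-by-residues x y ⟩
    (+ (x %ℕ n) - + (y %ℕ n)) + (x /ℕ n - y /ℕ n) * + n  ≡⟨ cong (λ r → (+ r - + (y %ℕ n)) + (x /ℕ n - y /ℕ n) * + n) same ⟩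
    (+ (y %ℕ n) - + (y %ℕ n)) + (x /ℕ n - y /ℕ n) * + n  ≡⟨ cancel (+ (y %ℕ n)) ((x /ℕ n - y /ℕ n) * + n) ⟩
    (x /ℕ n - y /ℕ n) * + n                              ∎)
    where
    open ≡-Reasoning
    cancel : ∀ r m → (r - r) + m ≡ m
    cancel = solve-∀

  congruent⇒same-residue : ∀ x y → + n ∣ x - y → x %ℕ n ≡ y %ℕ n
  congruent⇒same-residue x y n∣x-y =
    residue-unique (n%ℕd<d x n) (n%ℕd<d y n)
      (∣m+n∣n⇒∣m (subst (+ n ∣_) (difference-by-residues x y) n∣x-y)
                 (divides (x /ℕ n - y /ℕ n) refl))

  residue-periodic : PPeriodic n (_%ℕ n)
  residue-periodic x = congruent⇒same-residue (x + + n) x (divides 1ℤ (difference x (+ n)))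
    where
    difference : ∀ x m → (x + m) - x ≡ 1ℤ * m
    difference = solve-∀

  residue-zero⇒multiple : ∀ x → x %ℕ n ≡ (+ 0) %ℕ n → x ≡ (x /ℕ n) * + n
  residue-zero⇒multiple x zero-residue = begin
    x                               ≡⟨ a≡a%ℕn+[a/ℕn]*n x n ⟩
    + (x %ℕ n) + (x /ℕ n) * + n     ≡⟨ cong (λ r → + r + (x /ℕ n) * + n) (trans zero-residue (m*n%n≡0 0 n)) ⟩
    + 0 + (x /ℕ n) * + n            ≡⟨ ℤP.+-identityˡ ((x /ℕ n) * + n) ⟩
    (x /ℕ n) * + n                  ∎
    where open ≡-Reasoning

congruent-to-threshold : ∀ {q} (α : Seq) {K} →
  (∀ k → K ≤ k → q ∣ α k - α (suc k)) → ∀ {k} → K ≤′ k → q ∣ α k - α K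
congruent-to-threshold {q} α {K} steps ≤′-refl =
  divides 0ℤ (ℤP.+-inverseʳ (α K))
congruent-to-threshold {q} α {K} steps (≤′-step {k} K≤′k) =
  subst (q ∣_) (telescope (α K) (α k) (α (suc k)))
    (∣m∣n⇒∣m-n (congruent-to-threshold α steps K≤′k) (steps k (ℕP.≤′⇒≤ K≤′k)))
  where
  telescope : ∀ a b c → (b - a) - (b - c) ≡ c - a
  telescope = solve-∀

-- A polyadic sequence stabilizes every periodic function: modulo a period q
-- it is eventually constant.
polyadic⇒stabilizer : ∀ (α : Seq) → IsPolyadic α → Stabilizer α
polyadic⇒stabilizer α polyadic V u (ℕ.zero  , ()  , _)
polyadic⇒stabilizer α polyadic V u (q@(suc _) , _ , periodic) =
  let (K , steps) = polyadic q (ℕ.s≤s ℕ.z≤n) in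
  u (α K) , K , λ k K≤k →
    periodic-congruent periodic
      (congruent-to-threshold α (λ j K≤j → ∣ᵤ⇒∣ (steps j K≤j)) (ℕP.≤⇒≤′ K≤k))

-- A stabilizer is polyadic: stabilizing the residue map modulo n makes
-- consecutive terms eventually congruent modulo n.
stabilizer⇒polyadic : ∀ (α : Seq) → Stabilizer α → IsPolyadic α
stabilizer⇒polyadic α stabilizer ℕ.zero ()
stabilizer⇒polyadic α stabilizer n@(suc _) _ =
  let (_ , stable) = stabilizer ℕ (_%ℕ n) (n , ℕ.s≤s ℕ.z≤n , residue-periodic n) in
  eventually-map
    (λ k (now , next) → ∣⇒∣ᵤ (same-residue⇒congruent n (α k) (α (suc k)) (trans now (sym next))))
    (eventually-both stable (eventually-next stable))

Prezero : ℕ → Seq → Set₁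
Prezero p α = ∀ (V : Set) (u : ℤ → V) → PPeriodic p u → Stabilizes α u (u (+ 0))

-- If α is eventually congruent to pβ modulo p, then p eventually divides α,
-- so α stabilizes every p-periodic u at u 0.
congruent-to-multiple⇒prezero : ∀ p .{{_ : NonZero p}} (α β : Seq) →
  C₀ (λ k → α k - + p * β k) → Prezero p α
congruent-to-multiple⇒prezero p α β congruent V u periodic =
  eventually-map (λ k p∣α-pβ → periodic-congruent periodic (p∣α k (∣ᵤ⇒∣ p∣α-pβ)))
    (congruent p (ℕ.>-nonZero⁻¹ p))
  where
  p∣α : ∀ k → + p ∣ α k - + p * β k → + p ∣ α k - + 0
  p∣α k p∣α-pβ = subst (+ p ∣_) (add-back (α k) (+ p * β k))
    (∣m∣n⇒∣m+n p∣α-pβ (divides (β k) (ℤP.*-comm (+ p) (β k))))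
    where
    add-back : ∀ a b → (a - b) + b ≡ a - + 0
    add-back = solve-∀

prezero⇒eventually-multiple : ∀ p .{{_ : NonZero p}} (α : Seq) →
  Prezero p α → Eventually (λ k → α k ≡ (α k /ℕ p) * + p)
prezero⇒eventually-multiple p α prezero =
  eventually-map (λ k → residue-zero⇒multiple p (α k)) (prezero ℕ (_%ℕ p) (residue-periodic p))

-- Dividing a polyadic sequence by p: if α is polyadic and eventually α = βp,
-- then β is polyadic, since n·p ∣ α k - α (k+1) = (β k - β (k+1))·p.
quotient-polyadic : ∀ p .{{_ : NonZero p}} (α β : Seq) →
  IsPolyadic α → Eventually (λ k → α k ≡ β k * + p) → IsPolyadic β
quotient-polyadic p α β polyadic multiple ℕ.zero ()
quotient-polyadic p α β polyadic multiple n@(suc _) _ =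
  eventually-map (λ k hyps → ∣⇒∣ᵤ (cancel k hyps))
    (eventually-both (polyadic (n ℕ.* p) (ℕ.>-nonZero⁻¹ (n ℕ.* p) {{ℕP.m*n≢0 n p}}))
                     (eventually-both multiple (eventually-next multiple)))
  where
  cancel : ∀ k → (+ (n ℕ.* p)) Unsigned.∣ α k - α (suc k) ×
                 α k ≡ β k * + p × α (suc k) ≡ β (suc k) * + p →
           + n ∣ β k - β (suc k)
  cancel k (np∣Δα , now , next) = *-cancelʳ-∣ (+ p)
    (subst₂ _∣_ (ℤP.pos-* n p) Δα≡Δβ*p (∣ᵤ⇒∣ np∣Δα))
    where
    open ≡-Reasoning
    factor : ∀ a b q → a * q - b * q ≡ (a - b) * q
    factor = solve-∀
    Δα≡Δβ*p : α k - α (suc k) ≡ (β k - β (suc k)) * + p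
    Δα≡Δβ*p = begin
      α k - α (suc k)                ≡⟨ cong₂ _-_ now next ⟩
      β k * + p - β (suc k) * + p    ≡⟨ factor (β k) (β (suc k)) (+ p) ⟩
      (β k - β (suc k)) * + p        ∎

eventually-multiple⇒congruent : ∀ p (α β : Seq) →
  Eventually (λ k → α k ≡ β k * + p) → C₀ (λ k → α k - + p * β k)
eventually-multiple⇒congruent p α β multiple n _ = eventually-map divisible multiple
  where
  cancel : ∀ b q → b * q - q * b ≡ 0ℤ
  cancel = solve-∀
  vanishes : ∀ {k} → α k ≡ β k * + p → α k - + p * β k ≡ 0ℤ
  vanishes {k} α≡βp = trans (cong (_- + p * β k) α≡βp) (cancel (β k) (+ p))
  divisible : ∀ k → α k ≡ β k * + p → + n Unsigned.∣ α k - + p * β k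
  divisible k α≡βp = subst (+ n Unsigned.∣_) (sym (vanishes α≡βp)) (n ℕD.∣0)

prezero-stabilizer⇒in-p𝒫 : ∀ p .{{_ : NonZero p}} (α : Seq) →
  PrezeroStabilizer p α → RepresentsInPP p α
prezero-stabilizer⇒in-p𝒫 p α (stabilizer , prezero) =
  polyadic , β , quotient-polyadic p α β polyadic multiple ,
  eventually-multiple⇒congruent p α β multiple
  where
  polyadic : IsPolyadic α
  polyadic = stabilizer⇒polyadic α stabilizer
  β : Seq
  β k = α k /ℕ p
  multiple : Eventually (λ k → α k ≡ β k * + p)
  multiple = prezero⇒eventually-multiple p α prezero

in-p𝒫⇒prezero-stabilizer : ∀ p .{{_ : NonZero p}} (α : Seq) →
  RepresentsInPP p α → PrezeroStabilizer p α
in-p𝒫⇒prezero-stabilizer p α (polyadic , β , _ , congruent) =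
  polyadic⇒stabilizer α polyadic , congruent-to-multiple⇒prezero p α β congruent

mainTheorem16 : (p : ℕ) → 1 ≤ p → (α : Seq) →
    (PrezeroStabilizer p α → RepresentsInPP p α) × (RepresentsInPP p α → PrezeroStabilizer p α)
mainTheorem16 p 1≤p α = prezero-stabilizer⇒in-p𝒫 p α , in-p𝒫⇒prezero-stabilizer p α
  where
  instance
    p≢0 : NonZero p
    p≢0 = ℕ.>-nonZero 1≤p
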